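{- Let $A$, $B$, $C$ be $m \times n$ matrices over $\{ -1,0,1\}$ such that $A$ has at least one entry equal to $0$. If none of $A$, $B$, $C$ is a layered matrix, then ${\rm IST}(A,B,C)$ is finite.
   Context: For an $m\times n$ matrix $M=[m_{ij}]$ over $\{ -1,0,1\}$, $G_o(M)$ denotes the directed graph on vertex set $\{1,\dots,n+m\}$ with an edge $j\to i$ for all $1\le j<i\le n$, and, for each $1\le p\le m$ and $1\le j\le n$, an edge $j\to n+p$ if $m_{pj}=1$, an edge $n+p\to j$ if $m_{pj}=-1$, and no edge between $j$ and $n+p$ if $m_{pj}=0$; there are no edges among the vertices $n+1,\dots,n+m$. A directed graph (no loops or multiple edges) is semi-transitive if it is acyclic and for every directed path $u_1\to u_2\to\cdots\to u_t$ with $t\ge 2$, either there is no edge $u_1\to u_t$ or all edges $u_i\to u_j$ exist for $1\le i<j\le t$. Given $m\times n$ matrices $A,B,C$ over $\{ -1,0,1\}$, let $\varphi$ be the 2-dimensional morphism replacing every entry $0$ by the block $A$, every entry $1$ by the block $B$ and every entry $-1$ by the block $C$; $M^k(A,B,C)=\varphi^k([0])$ (so $M^0=[0]$ and $M^k$ is $m^k\times n^k$), and $G_o^k(A,B,C)=G_o(M^k(A,B,C))$. When $A$ has an entry $0$, the index of semi-transitivity ${\rm IST}(A,B,C)$ is the smallest integer $\ell\ge 0$ such that $G_o^\ell(A,B,C)$ is not semi-transitive, and ${\rm IST}(A,B,C)=\infty$ if no such $\ell$ exists. A matrix is layered if all entries in the same row are identical. -}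

module Defs where

open import Data.Nat using (ℕ; zero; suc; _+_; _*_; _^_)
open import Data.Fin using (Fin; zero; suc; toℕ; splitAt; remQuot; inject₁; fromℕ; _<_)
open import Data.Sum using (_⊎_; inj₁; inj₂)
open import Data.Product using (Σ; _×_; _,_; ∃-syntax)
open import Data.Empty using (⊥)
open import Relation.Nullary using (¬_)
open import Relation.Binary.PropositionalEquality using (_≡_)
open import Function.Definitions using (Injective)
import Data.Nat as ℕ

data Entry : Set where
  neg zer pos : Entry

Matrix : ℕ → ℕ → Set
Matrix m n = Fin m → Fin n → Entry

Layered : ∀ {m n} → Matrix m n → Set
Layered {m} {n} M = ∀ (p : Fin m) (j j′ : Fin n) → M p j ≡ M p j′

block : ∀ {m n} → Matrix m n → Matrix m n → Matrix m n → Entry → Matrix m n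
block A B C zer = A
block A B C pos = B
block A B C neg = C

-- Φ A B C ℓ x = φ^ℓ([x]), an m^ℓ × n^ℓ matrix, computed via φ^(ℓ+1) = φ^ℓ ∘ φ:
-- φ^(ℓ+1)([x]) = φ^ℓ(block x), whose (q,s) top-level block is φ^ℓ([block x q s]).
-- Row index in Fin (m * m^ℓ) decomposes as q * m^ℓ + r (remQuot).
Φ : ∀ {m n} → Matrix m n → Matrix m n → Matrix m n → (ℓ : ℕ) → Entry → Matrix (m ^ ℓ) (n ^ ℓ)
Φ A B C zero    x _ _ = x
Φ {m} {n} A B C (suc ℓ) x r c with remQuot (m ^ ℓ) r | remQuot (n ^ ℓ) c
... | q , r′ | s , c′ = Φ A B C ℓ (block A B C x q s) r′ c′

Mk : ∀ {m n} → Matrix m n → Matrix m n → Matrix m n → (k : ℕ) → Matrix (m ^ k) (n ^ k)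
Mk A B C k = Φ A B C k zer

Digraph : ℕ → Set₁
Digraph N = Fin N → Fin N → Set

-- G_o(M): vertices Fin (n + m); vertex j : Fin n is paper's j+1, vertex n + p is paper's n+p+1
Go : ∀ {m n} → Matrix m n → Digraph (n + m)
Go {m} {n} M u v with splitAt n u | splitAt n v
... | inj₁ j | inj₁ i = toℕ j ℕ.< toℕ i
... | inj₁ j | inj₂ p = M p j ≡ pos
... | inj₂ p | inj₁ j = M p j ≡ neg
... | inj₂ p | inj₂ q = ⊥

IsWalk : ∀ {N k} → Digraph N → (Fin (suc k) → Fin N) → Set
IsWalk {N} {k} E f = ∀ (i : Fin k) → E (f (inject₁ i)) (f (suc i))

Acyclic : ∀ {N} → Digraph N → Set
Acyclic {N} E = ¬ (Σ ℕ λ k → Σ (Fin (suc (suc k)) → Fin N) λ f →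
                    IsWalk E f × f zero ≡ f (fromℕ (suc k)))

SemiTransitive : ∀ {N} → Digraph N → Set
SemiTransitive {N} E =
  Acyclic E ×
  (∀ (k : ℕ) (f : Fin (suc (suc k)) → Fin N) → Injective _≡_ _≡_ f → IsWalk E f →
     E (f zero) (f (fromℕ (suc k))) → ∀ (i j : Fin (suc (suc k))) → i < j → E (f i) (f j))

Gok : ∀ {m n} → Matrix m n → Matrix m n → Matrix m n → (k : ℕ) → Digraph (n ^ k + m ^ k)
Gok A B C k = Go (Mk A B C k)

-- IST(A,B,C) is finite: some G_o^ℓ(A,B,C) is not semi-transitive
-- (then the least such ℓ exists, as semi-transitivity of finite graphs is decidable)
ISTFinite : ∀ {m n} → Matrix m n → Matrix m n → Matrix m n → Set
ISTFinite A B C = ∃[ ℓ ] ¬ SemiTransitive (Gok A B C ℓ)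

-- In G_o(M), a row p reading letters a b a b (a ≢ b) at columns j₁ < j₂ < j₃ < j₄ breaks
-- semi-transitivity: a −1 before a 1 closes the cycle p → j → i → p, and the patterns
-- 1 0 1 and −1 0 −1 at j < i < k give a shortcut j → p (resp. p → k) over the path through
-- i although i and p are not adjacent. Such a row occurs in M³(A,B,C). Fix a row q and two
-- columns d₁ < d₂ of A; the four entries φ(A q s) q t of M² with (s, t) ∈ {d₁, d₂}², listed
-- lexicographically, take only three values, so two cells (s, t) < (s′, t′) carry the same
-- letter y. As the block of y is not layered, some row r of it has distinct letters at
-- columns e₁ < e₂, and row (q, q, r) of M³ reads them at columns
-- (s, t, e₁) < (s, t, e₂) < (s′, t′, e₁) < (s′, t′, e₂).
module Submission where

open import Defs
open import Data.Nat using (ℕ; suc; _+_; _^_; z<s; s<s)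
import Data.Nat as ℕ
import Data.Nat.Properties as ℕₚ
open import Data.Fin using (Fin; zero; suc; toℕ; _<_; _↑ˡ_; _↑ʳ_; combine; splitAt; inject₁)
open import Data.Fin.Properties
  using (splitAt-↑ˡ; splitAt-↑ʳ; toℕ-combine; combine-monoˡ-<; remQuot-combine; toℕ<n;
         <-cmp; ¬∀⟶∃¬; all?; pigeonhole)
  renaming (_≟_ to _≟ᶠ_)
open import Data.Product using (∃-syntax; ∃₂; _,_; _×_; proj₁)
open import Data.Product.Relation.Binary.Lex.Strict using (×-Lex)
open import Data.Sum using (inj₁; inj₂; [_,_]′)
open import Relation.Nullary using (¬_; contradiction)
open import Relation.Nullary.Decidable using (map′)
open import Relation.Binary.Definitions using (DecidableEquality; tri<; tri≈; tri>)
open import Relation.Binary.PropositionalEquality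
  using (_≡_; _≢_; refl; sym; trans; cong; cong₂; subst₂; module ≡-Reasoning)
open import Function.Base using (_∘_)
open import Function.Definitions using (Injective)

toFin : Entry → Fin 3
toFin neg = zero
toFin zer = suc zero
toFin pos = suc (suc zero)

fromFin : Fin 3 → Entry
fromFin zero = neg
fromFin (suc zero) = zer
fromFin (suc (suc zero)) = pos

fromFin-toFin : ∀ x → fromFin (toFin x) ≡ x
fromFin-toFin neg = refl
fromFin-toFin zer = refl
fromFin-toFin pos = refl

toFin-injective : Injective _≡_ _≡_ toFin
toFin-injective {x} {y} e = trans (sym (fromFin-toFin x)) (trans (cong fromFin e) (fromFin-toFin y))

_≟ᴱ_ : DecidableEquality Entry
x ≟ᴱ y = map′ toFin-injective (cong toFin) (toFin x ≟ᶠ toFin y)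

entry-pigeonhole : ∀ {k} → 3 ℕ.< k → (w : Fin k → Entry) → ∃₂ λ i j → i < j × w i ≡ w j
entry-pigeonhole 3<k w with pigeonhole 3<k (λ i → toFin (w i))
... | i , j , i<j , e = i , j , i<j , toFin-injective e

¬Layered⇒distinct-in-row : ∀ {m n} (X : Matrix m n) → ¬ Layered X →
  ∃[ p ] ∃[ j ] ∃[ j′ ] (j < j′ × X p j ≢ X p j′)
¬Layered⇒distinct-in-row {m} {n} X ¬layered
  with p , ¬p ← ¬∀⟶∃¬ m _ (λ p → all? λ j → all? λ j′ → X p j ≟ᴱ X p j′) ¬layered
  with j , ¬j ← ¬∀⟶∃¬ n _ (λ j → all? λ j′ → X p j ≟ᴱ X p j′) ¬p
  with j′ , ¬j′ ← ¬∀⟶∃¬ n _ (λ j′ → X p j ≟ᴱ X p j′) ¬j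
  with <-cmp j j′
... | tri< j<j′ _ _ = p , j , j′ , j<j′ , ¬j′
... | tri≈ _ refl _ = contradiction refl ¬j′
... | tri> _ _ j′<j = p , j′ , j , j′<j , λ e → ¬j′ (sym e)

ascending : ∀ {k} (h : Fin (suc k) → ℕ) → (∀ i → h (inject₁ i) ℕ.< h (suc i)) →
  ∀ {i j} → i < j → h i ℕ.< h j
ascending {suc k} h step {zero} {suc zero} _ = step zero
ascending {suc k} h step {zero} {suc (suc j)} _ =
  ℕₚ.<-trans (step zero) (ascending (λ i → h (suc i)) (λ i → step (suc i)) {zero} {suc j} z<s)
ascending {suc k} h step {suc i} {suc j} (s<s i<j) =
  ascending (λ i → h (suc i)) (λ i → step (suc i)) i<j

ascending⇒injective : ∀ {k} {X : Set} (rank : X → ℕ) (f : Fin (suc k) → X) →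
  (∀ i → rank (f (inject₁ i)) ℕ.< rank (f (suc i))) → Injective _≡_ _≡_ f
ascending⇒injective rank f step {i} {j} e with <-cmp i j
... | tri< i<j _ _ = contradiction (cong rank e) (ℕₚ.<⇒≢ (ascending (rank ∘ f) step i<j))
... | tri≈ _ i≡j _ = i≡j
... | tri> _ _ j<i = contradiction (cong rank (sym e)) (ℕₚ.<⇒≢ (ascending (rank ∘ f) step j<i))

record Alternation {m n : ℕ} (M : Matrix m n) : Set where
  field
    p : Fin m
    j₁ j₂ j₃ j₄ : Fin n
    j₁<j₂ : j₁ < j₂
    j₂<j₃ : j₂ < j₃
    j₃<j₄ : j₃ < j₄
    M₁≡M₃ : M p j₁ ≡ M p j₃
    M₂≡M₄ : M p j₂ ≡ M p j₄
    M₁≢M₂ : M p j₁ ≢ M p j₂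

module Orientation {m n : ℕ} (M : Matrix m n) where

  column : Fin n → Fin (n + m)
  column j = j ↑ˡ m

  row : Fin m → Fin (n + m)
  row p = n ↑ʳ p

  column-edge : ∀ {j i} → j < i → Go M (column j) (column i)
  column-edge {j} {i} j<i rewrite splitAt-↑ˡ n j m | splitAt-↑ˡ n i m = j<i

  rising-edge : ∀ {p j} → M p j ≡ pos → Go M (column j) (row p)
  rising-edge {p} {j} e rewrite splitAt-↑ˡ n j m | splitAt-↑ʳ n m p = e

  rising-edge⁻¹ : ∀ {p j} → Go M (column j) (row p) → M p j ≡ pos
  rising-edge⁻¹ {p} {j} e rewrite splitAt-↑ˡ n j m | splitAt-↑ʳ n m p = e

  falling-edge : ∀ {p j} → M p j ≡ neg → Go M (row p) (column j)
  falling-edge {p} {j} e rewrite splitAt-↑ˡ n j m | splitAt-↑ʳ n m p = e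

  falling-edge⁻¹ : ∀ {p j} → Go M (row p) (column j) → M p j ≡ neg
  falling-edge⁻¹ {p} {j} e rewrite splitAt-↑ˡ n j m | splitAt-↑ʳ n m p = e

  -- Columns are ranked by position and all rows share the rank ρ; a walk along which
  -- this rank increases is a path.
  rank : ℕ → Fin (n + m) → ℕ
  rank ρ v = [ (λ j → suc (toℕ j)) , (λ _ → ρ) ]′ (splitAt n v)

  rank-column : ∀ ρ j → rank ρ (column j) ≡ suc (toℕ j)
  rank-column ρ j = cong [ (λ j → suc (toℕ j)) , (λ _ → ρ) ]′ (splitAt-↑ˡ n j m)

  rank-row : ∀ ρ p → rank ρ (row p) ≡ ρ
  rank-row ρ p = cong [ (λ j → suc (toℕ j)) , (λ _ → ρ) ]′ (splitAt-↑ʳ n m p)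

  rank-column-mono : ∀ ρ {j i} → j < i → rank ρ (column j) ℕ.< rank ρ (column i)
  rank-column-mono ρ {j} {i} j<i rewrite rank-column ρ j | rank-column ρ i = s<s j<i

  neg-before-pos⇒¬Acyclic : ∀ {p j i} → M p j ≡ neg → M p i ≡ pos → j < i → ¬ Acyclic (Go M)
  neg-before-pos⇒¬Acyclic {p} {j} {i} Mpj Mpi j<i acyclic = acyclic (2 , cycle , walk , refl)
    where
    cycle : Fin 4 → Fin (n + m)
    cycle zero = row p
    cycle (suc zero) = column j
    cycle (suc (suc zero)) = column i
    cycle (suc (suc (suc zero))) = row p

    walk : IsWalk (Go M) cycle
    walk zero = falling-edge Mpj
    walk (suc zero) = column-edge j<i
    walk (suc (suc zero)) = rising-edge Mpi

  pos-zer-pos⇒¬SemiTransitive : ∀ {p j i k} → M p j ≡ pos → M p i ≡ zer → M p k ≡ pos →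
    j < i → i < k → ¬ SemiTransitive (Go M)
  pos-zer-pos⇒¬SemiTransitive {p} {j} {i} {k} Mpj Mpi Mpk j<i i<k (_ , shortcut) =
    zer≢pos (trans (sym Mpi) (rising-edge⁻¹ i→p))
    where
    zer≢pos : zer ≢ pos
    zer≢pos ()

    path : Fin 4 → Fin (n + m)
    path zero = column j
    path (suc zero) = column i
    path (suc (suc zero)) = column k
    path (suc (suc (suc zero))) = row p

    walk : IsWalk (Go M) path
    walk zero = column-edge j<i
    walk (suc zero) = column-edge i<k
    walk (suc (suc zero)) = rising-edge Mpk

    injective : Injective _≡_ _≡_ path
    injective = ascending⇒injective (rank (suc n)) path λ where
      zero → rank-column-mono (suc n) j<i
      (suc zero) → rank-column-mono (suc n) i<k
      (suc (suc zero)) → subst₂ ℕ._<_ (sym (rank-column (suc n) k)) (sym (rank-row (suc n) p))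
                                        (s<s (toℕ<n k))

    i→p : Go M (column i) (row p)
    i→p = shortcut 2 path injective walk (rising-edge Mpj)
                   (suc zero) (suc (suc (suc zero))) (s<s z<s)

  neg-zer-neg⇒¬SemiTransitive : ∀ {p j i k} → M p j ≡ neg → M p i ≡ zer → M p k ≡ neg →
    j < i → i < k → ¬ SemiTransitive (Go M)
  neg-zer-neg⇒¬SemiTransitive {p} {j} {i} {k} Mpj Mpi Mpk j<i i<k (_ , shortcut) =
    zer≢neg (trans (sym Mpi) (falling-edge⁻¹ p→i))
    where
    zer≢neg : zer ≢ neg
    zer≢neg ()

    path : Fin 4 → Fin (n + m)
    path zero = row p
    path (suc zero) = column j
    path (suc (suc zero)) = column i
    path (suc (suc (suc zero))) = column k

    walk : IsWalk (Go M) path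
    walk zero = falling-edge Mpj
    walk (suc zero) = column-edge j<i
    walk (suc (suc zero)) = column-edge i<k

    injective : Injective _≡_ _≡_ path
    injective = ascending⇒injective (rank 0) path λ where
      zero → subst₂ ℕ._<_ (sym (rank-row 0 p)) (sym (rank-column 0 j)) z<s
      (suc zero) → rank-column-mono 0 j<i
      (suc (suc zero)) → rank-column-mono 0 i<k

    p→i : Go M (row p) (column i)
    p→i = shortcut 2 path injective walk (falling-edge Mpk) zero (suc (suc zero)) z<s

  alternation⇒¬SemiTransitive : Alternation M → ¬ SemiTransitive (Go M)
  alternation⇒¬SemiTransitive alt = by-letters (M p j₁) (M p j₂) refl refl
    where
    open Alternation alt

    by-letters : ∀ a b → M p j₁ ≡ a → M p j₂ ≡ b → ¬ SemiTransitive (Go M)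
    by-letters neg neg e₁ e₂ = contradiction (trans e₁ (sym e₂)) M₁≢M₂
    by-letters zer zer e₁ e₂ = contradiction (trans e₁ (sym e₂)) M₁≢M₂
    by-letters pos pos e₁ e₂ = contradiction (trans e₁ (sym e₂)) M₁≢M₂
    by-letters neg pos e₁ e₂ = neg-before-pos⇒¬Acyclic e₁ e₂ j₁<j₂ ∘ proj₁
    by-letters pos neg e₁ e₂ = neg-before-pos⇒¬Acyclic e₂ (trans (sym M₁≡M₃) e₁) j₂<j₃ ∘ proj₁
    by-letters pos zer e₁ e₂ = pos-zer-pos⇒¬SemiTransitive e₁ e₂ (trans (sym M₁≡M₃) e₁) j₁<j₂ j₂<j₃
    by-letters zer pos e₁ e₂ =
      pos-zer-pos⇒¬SemiTransitive e₂ (trans (sym M₁≡M₃) e₁) (trans (sym M₂≡M₄) e₂) j₂<j₃ j₃<j₄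
    by-letters neg zer e₁ e₂ = neg-zer-neg⇒¬SemiTransitive e₁ e₂ (trans (sym M₁≡M₃) e₁) j₁<j₂ j₂<j₃
    by-letters zer neg e₁ e₂ =
      neg-zer-neg⇒¬SemiTransitive e₂ (trans (sym M₁≡M₃) e₁) (trans (sym M₂≡M₄) e₂) j₂<j₃ j₃<j₄

combine-monoʳ-< : ∀ {a b} (i : Fin a) {j j′ : Fin b} → j < j′ → combine i j < combine i j′
combine-monoʳ-< {a} {b} i {j} {j′} j<j′ rewrite toℕ-combine i j | toℕ-combine i j′ =
  ℕₚ.+-monoʳ-< (b ℕ.* toℕ i) j<j′

triple : ∀ {k} → Fin k → Fin k → Fin k → Fin (k ^ 3)
triple a b c = combine a (combine b (combine c zero))

triple-monoʳ-< : ∀ {k} (s t : Fin k) {c c′} → c < c′ → triple s t c < triple s t c′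
triple-monoʳ-< s t c<c′ = combine-monoʳ-< s (combine-monoʳ-< t (combine-monoˡ-< zero zero c<c′))

triple-lex-< : ∀ {k} {s t s′ t′ : Fin k} → ×-Lex _≡_ _<_ _<_ (s , t) (s′ , t′) →
  ∀ c c′ → triple s t c < triple s′ t′ c′
triple-lex-< (inj₁ s<s′) c c′ = combine-monoˡ-< _ _ s<s′
triple-lex-< {s = s} (inj₂ (refl , t<t′)) c c′ = combine-monoʳ-< s (combine-monoˡ-< _ _ t<t′)

square : ∀ {k} → Fin k → Fin k → Fin 4 → Fin k × Fin k
square d₁ d₂ zero = d₁ , d₁
square d₁ d₂ (suc zero) = d₁ , d₂
square d₁ d₂ (suc (suc zero)) = d₂ , d₁
square d₁ d₂ (suc (suc (suc zero))) = d₂ , d₂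

square-lex : ∀ {k} {d₁ d₂ : Fin k} → d₁ < d₂ → ∀ {i j} → i < j →
  ×-Lex _≡_ _<_ _<_ (square d₁ d₂ i) (square d₁ d₂ j)
square-lex d₁<d₂ {zero} {suc zero} _ = inj₂ (refl , d₁<d₂)
square-lex d₁<d₂ {zero} {suc (suc zero)} _ = inj₁ d₁<d₂
square-lex d₁<d₂ {zero} {suc (suc (suc zero))} _ = inj₁ d₁<d₂
square-lex d₁<d₂ {suc zero} {suc (suc zero)} _ = inj₁ d₁<d₂
square-lex d₁<d₂ {suc zero} {suc (suc (suc zero))} _ = inj₁ d₁<d₂
square-lex d₁<d₂ {suc (suc zero)} {suc (suc (suc zero))} _ = inj₂ (refl , d₁<d₂)
square-lex d₁<d₂ {suc zero} {suc zero} (s<s ())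
square-lex d₁<d₂ {suc (suc _)} {suc zero} (s<s ())
square-lex d₁<d₂ {suc (suc _)} {suc (suc zero)} (s<s (s<s ()))
square-lex d₁<d₂ {suc (suc (suc _))} {suc (suc (suc zero))} (s<s (s<s (s<s ())))

module Substitution {m n : ℕ} (A B C : Matrix m n) where

  φ : Entry → Matrix m n
  φ = block A B C

  Φ-combine : ∀ ℓ x (q : Fin m) (r : Fin (m ^ ℓ)) (s : Fin n) (c : Fin (n ^ ℓ)) →
    Φ A B C (suc ℓ) x (combine q r) (combine s c) ≡ Φ A B C ℓ (φ x q s) r c
  Φ-combine ℓ x q r s c =
    cong₂ (λ (q′ , r′) (s′ , c′) → Φ A B C ℓ (φ x q′ s′) r′ c′)
          (remQuot-combine q r) (remQuot-combine s c)

  Mk3-triple : ∀ q q′ r s t c → Mk A B C 3 (triple q q′ r) (triple s t c) ≡ φ (φ (A q s) q′ t) r c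
  Mk3-triple q q′ r s t c = begin
    Φ A B C 3 zer (triple q q′ r) (triple s t c)
      ≡⟨ Φ-combine 2 zer q _ s _ ⟩
    Φ A B C 2 (A q s) (combine q′ (combine r zero)) (combine t (combine c zero))
      ≡⟨ Φ-combine 1 (A q s) q′ _ t _ ⟩
    Φ A B C 1 (φ (A q s) q′ t) (combine r zero) (combine c zero)
      ≡⟨ Φ-combine 0 (φ (A q s) q′ t) r zero c zero ⟩
    φ (φ (A q s) q′ t) r c
      ∎
    where open ≡-Reasoning

  -- the letter in row (q, q) and column (s, t) of M²
  letter : Fin m → Fin n × Fin n → Entry
  letter q (s , t) = φ (A q s) q t

  repeated-letter⇒alternation : ∀ {q cell cell′} → ×-Lex _≡_ _<_ _<_ cell cell′ →
    letter q cell ≡ letter q cell′ → ¬ Layered (φ (letter q cell)) → Alternation (Mk A B C 3)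
  repeated-letter⇒alternation {q} {s , t} {s′ , t′} cell<cell′ same ¬layered
    with r , e₁ , e₂ , e₁<e₂ , differ ← ¬Layered⇒distinct-in-row _ ¬layered = record
      { p = triple q q r
      ; j₁ = triple s t e₁ ; j₂ = triple s t e₂ ; j₃ = triple s′ t′ e₁ ; j₄ = triple s′ t′ e₂
      ; j₁<j₂ = triple-monoʳ-< s t e₁<e₂
      ; j₂<j₃ = triple-lex-< cell<cell′ e₂ e₁
      ; j₃<j₄ = triple-monoʳ-< s′ t′ e₁<e₂
      ; M₁≡M₃ = same-letter e₁
      ; M₂≡M₄ = same-letter e₂
      ; M₁≢M₂ = λ e →
          differ (trans (sym (Mk3-triple q q r s t e₁)) (trans e (Mk3-triple q q r s t e₂)))
      }
    where
    same-letter : ∀ c →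
      Mk A B C 3 (triple q q r) (triple s t c) ≡ Mk A B C 3 (triple q q r) (triple s′ t′ c)
    same-letter c = trans (Mk3-triple q q r s t c)
      (trans (cong (λ y → φ y r c) same) (sym (Mk3-triple q q r s′ t′ c)))

  ¬Layered-blocks⇒alternation : (∀ x → ¬ Layered (φ x)) → Alternation (Mk A B C 3)
  ¬Layered-blocks⇒alternation ¬layered
    with q , d₁ , d₂ , d₁<d₂ , _ ← ¬Layered⇒distinct-in-row A (¬layered zer)
    with i , j , i<j , same ← entry-pigeonhole (ℕₚ.n<1+n 3) (λ i → letter q (square d₁ d₂ i))
    = repeated-letter⇒alternation (square-lex d₁<d₂ i<j) same (¬layered _)

-- The zero entry of A only makes IST(A,B,C) well defined; finiteness does not need it.
theorem3p10 : (m n : ℕ) (A B C : Matrix m n) →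
    (∃[ p ] ∃[ j ] A p j ≡ zer) →
    ¬ Layered A → ¬ Layered B → ¬ Layered C →
    ISTFinite A B C
theorem3p10 m n A B C _ ¬layered-A ¬layered-B ¬layered-C =
  3 , Orientation.alternation⇒¬SemiTransitive _
        (Substitution.¬Layered-blocks⇒alternation A B C ¬layered)
  where
  ¬layered : ∀ x → ¬ Layered (block A B C x)
  ¬layered neg = ¬layered-C
  ¬layered zer = ¬layered-A
  ¬layered pos = ¬layered-B
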